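{- Given integers $w_1>s\geq 2$ and $(w_1,s)\not \in\{(4,2),(5,2)\}$, let $e_1=w_1-s-1$ and $e_2=s+2$, and $\mu=6w_1-4s$. Then there exists a GDP$(\mu,3^{e_1}2^{e_2})$ over $\mathbb{Z}_{\mu}$ with three specified base blocks $\{0,1\}$, $\{0,2\}$ and $\{0,\mu/2-1\}$.
   Context: A GDP$(M,3^{e_1}2^{e_2})$ (generalized difference packing) over $\mathbb{Z}_M$ is a collection of $e_1$ subsets of size $3$ and $e_2$ subsets of size $2$ of $\mathbb{Z}_M$ (base blocks) such that every nonzero element of $\mathbb{Z}_M$ occurs at most once among the differences $b-b'$ ($b\neq b'$ in a common base block). -}

module Defs where

open import Data.Nat using (ℕ; _+_; _∸_; _≤?_; _<_)
open import Data.List using (List; []; _∷_; _++_; concatMap; length)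
open import Data.Vec using (Vec; toList)
open import Data.List.Relation.Unary.All using (All)
open import Data.List.Relation.Unary.Unique.Propositional using (Unique)
import Data.Vec.Relation.Unary.All as VAll
open import Relation.Binary.PropositionalEquality using (_≡_)
open import Relation.Nullary using (yes; no)

-- Elements of ℤ_M are represented by naturals 0 ≤ x < M.
-- The difference a - b in ℤ_M (for a, b < M), as a representative in [0, M).
diffℤ : ℕ → ℕ → ℕ → ℕ
diffℤ M a b with b ≤? a
... | yes _ = a ∸ b
... | no  _ = (M + a) ∸ b

differences : ℕ → List ℕ → List ℕ
differences M []       = []
differences M (x ∷ xs) =
  concatMap (λ y → diffℤ M x y ∷ diffℤ M y x ∷ []) xs ++ differences M xs

record IsBlock (M k : ℕ) (B : List ℕ) : Set where
  field
    size     : length B ≡ k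
    distinct : Unique B
    inRange  : All (_< M) B

-- GDP(M, 3^{e1} 2^{e2}) over ℤ_M: e1 base blocks of size 3 and e2 of size 2
-- such that every nonzero element of ℤ_M occurs at most once among the
-- differences, i.e. the list of all differences has no repetition.
record GDP (M e1 e2 : ℕ) : Set where
  field
    triples    : Vec (List ℕ) e1
    pairs      : Vec (List ℕ) e2
    triples-ok : VAll.All (IsBlock M 3) triples
    pairs-ok   : VAll.All (IsBlock M 2) pairs
    packing    : Unique (concatMap (differences M) (toList triples ++ toList pairs))

module Submission where

-- Put μ = 2H.  For 0 < h < H the two differences ±h are the
-- residues h ∈ (0, H) and 2H - h ∈ (H, 2H); hence a family of blocks is a
-- packing over ℤ_{2H} as soon as its "half-differences" are distinct numbers
-- of (0, H).  A triple {0, a, a + x} has half-differences a, x, a + x and a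
-- pair {0, v} has the single half-difference v.  With n = w₁ - s - 1 and
-- K = H - 1 = 3n + s + 2 = μ/2 - 1 it therefore suffices to partition
-- {1, …, K} into n sets {a, x, a + x} and s + 2 singletons containing 1, 2, K.
--
-- Triple
-- systems with at most s - 1 holes are built by hand for n ≤ 2 and by a
-- Skolem-type nested construction for n ≥ 3 (separately for odd and even n);
-- the two excluded parameter pairs are exactly where this fails.

open import Defs
open import Data.Nat using (ℕ; zero; suc; _+_; _*_; _∸_; _/_; _≤_; _<_; _≤?_; z≤n; s≤s)
open import Data.Nat.Properties
open import Data.Nat.DivMod using (m*n/n≡m)
open import Data.Nat.Tactic.RingSolver using (solve-∀)
open import Data.List using (List; []; _∷_; _++_; [_]; concat; concatMap; length; map)
open import Data.List.Properties using (map-++; concat-++; length-++; ++-assoc)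
open import Data.List.Membership.Propositional using (_∈_)
open import Data.List.Membership.Propositional.Properties using (∈-map⁻)
open import Data.List.Relation.Unary.All as All using (All; []; _∷_)
import Data.List.Relation.Unary.All.Properties as AllP
import Data.List.Relation.Unary.Any as LAny
open import Data.List.Relation.Unary.AllPairs using ([]; _∷_)
open import Data.List.Relation.Unary.Unique.Propositional using (Unique)
import Data.List.Relation.Unary.Unique.Propositional.Properties as UniqueP
open import Data.List.Relation.Binary.Permutation.Propositional
  using (_↭_; ↭-refl; ↭-sym; ↭-trans; ↭-reflexive; prep; ↭⇒↭ₛ; module PermutationReasoning)
open import Data.List.Relation.Binary.Permutation.Propositional.Properties
  using (All-resp-↭; ++⁺ˡ; ++⁺ʳ; ++⁺; shift; ++-comm; ++-commutativeMonoid)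
open import Algebra.Solver.CommutativeMonoid (++-commutativeMonoid {A = ℕ})
  using (solve; _⊕_; _⊜_)
open import Data.List.Sort.InsertionSort.Base ≤-decTotalOrder using (sort)
open import Data.List.Sort.InsertionSort.Properties ≤-decTotalOrder using (sort-↭)
open import Data.Vec as Vec using (toList; fromList)
open import Data.Vec.Properties using (toList-map; toList∘fromList)
import Data.Vec.Relation.Unary.All.Properties as VAllP
open import Data.Vec.Relation.Unary.Any using (Any)
import Data.Vec.Relation.Unary.Any.Properties as VAnyP
open import Data.Product using (Σ; _×_; _,_; proj₁; proj₂)
open import Data.Sum using (_⊎_; inj₁; inj₂)
open import Data.Empty using (⊥; ⊥-elim)
open import Relation.Binary.PropositionalEquality
  using (_≡_; refl; sym; trans; cong; cong₂; subst; subst₂; setoid; module ≡-Reasoning)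
open import Relation.Nullary using (¬_; yes; no)
open import Data.List.Relation.Binary.Permutation.Setoid.Properties (setoid ℕ)
  using (Unique-resp-↭)

interval : ℕ → ℕ → List ℕ
interval a zero    = []
interval a (suc k) = a ∷ interval (suc a) k

interval-++ : ∀ a k j → interval a (k + j) ≡ interval a k ++ interval (a + k) j
interval-++ a zero    j = cong (λ b → interval b j) (sym (+-identityʳ a))
interval-++ a (suc k) j = cong (a ∷_) (trans (interval-++ (suc a) k j)
  (cong (λ b → interval (suc a) k ++ interval b j) (sym (+-suc a k))))

interval-length : ∀ a k → length (interval a k) ≡ k
interval-length a zero    = refl
interval-length a (suc k) = cong suc (interval-length (suc a) k)

interval-bounds : ∀ a k → All (λ x → a ≤ x × x < a + k) (interval a k)
interval-bounds a zero    = []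
interval-bounds a (suc k) =
  (≤-refl , subst (a <_) (sym (+-suc a k)) (s≤s (m≤m+n a k)))
  ∷ All.map (λ { {x} (a<x , x<) → <⇒≤ a<x , subst (x <_) (sym (+-suc a k)) x< })
            (interval-bounds (suc a) k)

interval-unique : ∀ a k → Unique (interval a k)
interval-unique a zero    = []
interval-unique a (suc k) =
  All.map (λ bounds → <⇒≢ (proj₁ bounds)) (interval-bounds (suc a) k)
  ∷ interval-unique (suc a) k

unique-resp-↭ : ∀ {xs ys : List ℕ} → xs ↭ ys → Unique xs → Unique ys
unique-resp-↭ p = Unique-resp-↭ (↭⇒↭ₛ p)

↭-by-sorting : ∀ (xs ys : List ℕ) → sort xs ≡ sort ys → xs ↭ ys
↭-by-sorting xs ys same = ↭-trans (↭-sym (sort-↭ xs)) (subst (_↭ ys) (sym same) (sort-↭ ys))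

concatMap-++ : ∀ {A B : Set} (f : A → List B) xs ys →
  concatMap f (xs ++ ys) ≡ concatMap f xs ++ concatMap f ys
concatMap-++ f xs ys = trans (cong concat (map-++ f xs ys)) (sym (concat-++ (map f xs) (map f ys)))

plusMinus : ℕ → List ℕ → List ℕ
plusMinus M = concatMap (λ h → M ∸ h ∷ h ∷ [])

plusMinus-↭ : ∀ M hs → plusMinus M hs ↭ map (M ∸_) hs ++ hs
plusMinus-↭ M []       = ↭-refl
plusMinus-↭ M (h ∷ hs) =
  prep (M ∸ h) (↭-trans (prep h (plusMinus-↭ M hs)) (↭-sym (shift h (map (M ∸_) hs) hs)))

unique-map : ∀ {P : ℕ → Set} (f : ℕ → ℕ) →
  (∀ {x y} → P x → P y → f x ≡ f y → x ≡ y) →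
  ∀ {xs} → All P xs → Unique xs → Unique (map f xs)
unique-map f inj []         []         = []
unique-map f inj (px ∷ pxs) (x∉ ∷ uxs) =
  AllP.map⁺ (All.zipWith (λ { (x≢y , py) fx≡fy → x≢y (inj px py fx≡fy) }) (x∉ , pxs))
    ∷ unique-map f inj pxs uxs

-- Distinct half-differences in [0, H) give distinct signed differences in
-- ℤ_{2H}: the values h lie below H and the values 2H - h lie above H.
plusMinus-unique : ∀ H {hs} → Unique hs → All (_< H) hs → Unique (plusMinus (H + H) hs)
plusMinus-unique H {hs} uhs small =
  unique-resp-↭ (↭-sym (plusMinus-↭ (H + H) hs))
    (UniqueP.++⁺ (unique-map (H + H ∸_) reflect-injective small uhs) uhs disjoint)
  where
  below : ∀ {h} → h < H → h < H + H
  below h<H = <-≤-trans h<H (m≤m+n H H)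

  reflect-injective : ∀ {h h'} → h < H → h' < H → H + H ∸ h ≡ H + H ∸ h' → h ≡ h'
  reflect-injective h<H h'<H = ∸-cancelˡ-≡ (<⇒≤ (below h<H)) (<⇒≤ (below h'<H))

  reflect-large : ∀ {h} → h < H → H < H + H ∸ h
  reflect-large {h} h<H = begin-strict
    H             ≡⟨ m+n∸m≡n h H ⟨
    h + H ∸ h     <⟨ ∸-monoˡ-< (+-monoˡ-< H h<H) (m≤m+n h H) ⟩
    H + H ∸ h     ∎
    where open ≤-Reasoning

  disjoint : ∀ {v} → v ∈ map (H + H ∸_) hs × v ∈ hs → ⊥
  disjoint (v∈neg , v∈hs) with ∈-map⁻ (H + H ∸_) v∈neg
  ... | h , h∈hs , refl = <-asym (All.lookup small v∈hs) (reflect-large (All.lookup small h∈hs))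

triple : ℕ × ℕ → List ℕ
triple (a , x) = 0 ∷ a ∷ a + x ∷ []

halvesOf : ℕ × ℕ → List ℕ
halvesOf (a , x) = a ∷ a + x ∷ x ∷ []

halves : List (ℕ × ℕ) → List ℕ
halves = concatMap halvesOf

pair : ℕ → List ℕ
pair v = 0 ∷ v ∷ []

diffℤ-≥ : ∀ M {a b} → b ≤ a → diffℤ M a b ≡ a ∸ b
diffℤ-≥ M {a} {b} b≤a with b ≤? a
... | yes _   = refl
... | no  b≰a = ⊥-elim (b≰a b≤a)

diffℤ-< : ∀ M {a b} → a < b → diffℤ M a b ≡ M + a ∸ b
diffℤ-< M {a} {b} a<b with b ≤? a
... | yes b≤a = ⊥-elim (<⇒≱ a<b b≤a)
... | no  _   = refl

diffℤ-to : ∀ M {v} → 0 < v → diffℤ M 0 v ≡ M ∸ v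
diffℤ-to M {v} 0<v = trans (diffℤ-< M 0<v) (cong (_∸ v) (+-identityʳ M))

diffℤ-from : ∀ M v → diffℤ M v 0 ≡ v
diffℤ-from M v = diffℤ-≥ M z≤n

diffℤ-up : ∀ M a {x} → 0 < x → diffℤ M a (a + x) ≡ M ∸ x
diffℤ-up M a {x} 0<x = begin
  diffℤ M a (a + x)  ≡⟨ diffℤ-< M (m<m+n a 0<x) ⟩
  M + a ∸ (a + x)    ≡⟨ cong (_∸ (a + x)) (+-comm M a) ⟩
  a + M ∸ (a + x)    ≡⟨ [m+n]∸[m+o]≡n∸o a M x ⟩
  M ∸ x              ∎
  where open ≡-Reasoning

diffℤ-down : ∀ M a x → diffℤ M (a + x) a ≡ x
diffℤ-down M a x = trans (diffℤ-≥ M (m≤m+n a x)) (m+n∸m≡n a x)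

differences-triple : ∀ M {a x} → 0 < a → 0 < x →
  differences M (triple (a , x)) ≡ plusMinus M (halvesOf (a , x))
differences-triple M {a} {x} 0<a 0<x
  rewrite diffℤ-to M 0<a | diffℤ-from M a | diffℤ-to M (<-≤-trans 0<a (m≤m+n a x))
        | diffℤ-from M (a + x) | diffℤ-up M a 0<x | diffℤ-down M a x = refl

differences-pair : ∀ M {v} → 0 < v → differences M (pair v) ≡ plusMinus M [ v ]
differences-pair M {v} 0<v rewrite diffℤ-to M 0<v | diffℤ-from M v = refl

differences-triples : ∀ M T → All (0 <_) (halves T) →
  concatMap (differences M) (map triple T) ≡ plusMinus M (halves T)
differences-triples M []            []                   = refl
differences-triples M ((a , x) ∷ T) (0<a ∷ _ ∷ 0<x ∷ pos) =
  trans (cong₂ _++_ (differences-triple M 0<a 0<x) (differences-triples M T pos))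
        (sym (concatMap-++ (λ h → M ∸ h ∷ h ∷ []) (halvesOf (a , x)) (halves T)))

differences-pairs : ∀ M P → All (0 <_) P →
  concatMap (differences M) (map pair P) ≡ plusMinus M P
differences-pairs M []      []         = refl
differences-pairs M (v ∷ P) (0<v ∷ pos) = cong₂ _++_ (differences-pair M 0<v) (differences-pairs M P pos)

triple-isBlock : ∀ {M a x} → 0 < a → 0 < x → a + x < M → IsBlock M 3 (triple (a , x))
triple-isBlock {M} {a} {x} 0<a 0<x a+x<M = record
  { size     = refl
  ; distinct = (<⇒≢ 0<a ∷ <⇒≢ 0<a+x ∷ []) ∷ (<⇒≢ (m<m+n a 0<x) ∷ []) ∷ [] ∷ []
  ; inRange  = <-≤-trans 0<a+x (<⇒≤ a+x<M) ∷ ≤-<-trans (m≤m+n a x) a+x<M ∷ a+x<M ∷ []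
  }
  where
  0<a+x : 0 < a + x
  0<a+x = <-≤-trans 0<a (m≤m+n a x)

pair-isBlock : ∀ {M v} → 0 < v → v < M → IsBlock M 2 (pair v)
pair-isBlock 0<v v<M = record
  { size     = refl
  ; distinct = (<⇒≢ 0<v ∷ []) ∷ [] ∷ []
  ; inRange  = ≤-<-trans z≤n v<M ∷ v<M ∷ []
  }

triples-areBlocks : ∀ M T → All (λ h → 0 < h × h < M) (halves T) →
  All (λ t → IsBlock M 3 (triple t)) T
triples-areBlocks M []            []                                  = []
triples-areBlocks M ((a , x) ∷ T) ((0<a , _) ∷ (_ , a+x<M) ∷ (0<x , _) ∷ bounds) =
  triple-isBlock 0<a 0<x a+x<M ∷ triples-areBlocks M T bounds

pairs-areBlocks : ∀ M P → All (λ h → 0 < h × h < M) P → All (λ v → IsBlock M 2 (pair v)) P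
pairs-areBlocks M P = All.map (λ { (0<v , v<M) → pair-isBlock 0<v v<M })

toList-map-fromList : ∀ {A B : Set} (f : A → B) xs → toList (Vec.map f (fromList xs)) ≡ map f xs
toList-map-fromList f xs = trans (toList-map f (fromList xs)) (cong (map f) (toList∘fromList xs))

GDPWith : ℕ → ℕ → ℕ → ℕ → Set
GDPWith μ e₁ e₂ v = Σ (GDP μ e₁ e₂) λ G →
  Any (_↭ pair 1) (GDP.pairs G) × Any (_↭ pair 2) (GDP.pairs G) × Any (_↭ pair v) (GDP.pairs G)

GDPWith-cong : ∀ {μ μ' e₁ e₁' e₂ e₂' v v'} → μ ≡ μ' → e₁ ≡ e₁' → e₂ ≡ e₂' → v ≡ v' →
  GDPWith μ e₁ e₂ v → GDPWith μ' e₁' e₂' v'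
GDPWith-cong refl refl refl refl G = G

gdp-of-partition : ∀ K (T : List (ℕ × ℕ)) (P : List ℕ) → halves T ++ P ↭ interval 1 K →
  Σ (GDP (suc K + suc K) (length T) (length P)) λ G →
    ∀ {v} → v ∈ P → Any (_↭ pair v) (GDP.pairs G)
gdp-of-partition K T P partition = G , pair-present
  where
  H M : ℕ
  H = suc K
  M = H + H

  bounded : All (λ h → 0 < h × h < H) (halves T ++ P)
  bounded = All-resp-↭ (↭-sym partition) (interval-bounds 1 K)

  boundedₘ : All (λ h → 0 < h × h < M) (halves T ++ P)
  boundedₘ = All.map (λ { (0<h , h<H) → 0<h , <-≤-trans h<H (m≤m+n H H) }) bounded

  distinct : Unique (halves T ++ P)
  distinct = unique-resp-↭ (↭-sym partition) (interval-unique 1 K)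

  positive : All (0 <_) (halves T ++ P)
  positive = All.map proj₁ bounded

  all-differences : concatMap (differences M) (map triple T ++ map pair P) ≡ plusMinus M (halves T ++ P)
  all-differences = begin
    concatMap (differences M) (map triple T ++ map pair P)
      ≡⟨ concatMap-++ (differences M) (map triple T) (map pair P) ⟩
    concatMap (differences M) (map triple T) ++ concatMap (differences M) (map pair P)
      ≡⟨ cong₂ _++_ (differences-triples M T (AllP.++⁻ˡ (halves T) positive))
                    (differences-pairs M P (AllP.++⁻ʳ (halves T) positive)) ⟩
    plusMinus M (halves T) ++ plusMinus M P
      ≡⟨ concatMap-++ (λ h → M ∸ h ∷ h ∷ []) (halves T) P ⟨
    plusMinus M (halves T ++ P)
      ∎
    where open ≡-Reasoning

  G : GDP M (length T) (length P)
  G = record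
    { triples    = Vec.map triple (fromList T)
    ; pairs      = Vec.map pair (fromList P)
    ; triples-ok = VAllP.map⁺ (VAllP.fromList⁺ (triples-areBlocks M T (AllP.++⁻ˡ (halves T) boundedₘ)))
    ; pairs-ok   = VAllP.map⁺ (VAllP.fromList⁺ (pairs-areBlocks M P (AllP.++⁻ʳ (halves T) boundedₘ)))
    ; packing    = subst Unique
        (sym (trans (cong₂ (λ ts ps → concatMap (differences M) (ts ++ ps))
                           (toList-map-fromList triple T) (toList-map-fromList pair P))
                    all-differences))
        (plusMinus-unique H distinct (All.map proj₂ bounded))
    }

  pair-present : ∀ {v} → v ∈ P → Any (_↭ pair v) (GDP.pairs G)
  pair-present v∈P =
    VAnyP.map⁺ (VAnyP.fromList⁺ (LAny.map (λ v≡u → ↭-reflexive (cong pair (sym v≡u))) v∈P))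

record TripleSystem (n : ℕ) (holes : List ℕ) : Set where
  field
    triples   : List (ℕ × ℕ)
    count     : length triples ≡ n
    partition : halves triples ++ holes ↭ interval 3 (n + n + n + length holes)

-- Every triple system yields the required GDP for K = 3n + #holes + r + 3:
-- the pairs are 1, 2, K, the holes and the r numbers above the system's
-- interval, so that the half-differences are exactly 1, …, K.
gdp-of-system : ∀ {n holes} → TripleSystem n holes → ∀ r →
  GDPWith (4 + (n + n + n + length holes + r) + (4 + (n + n + n + length holes + r)))
          n (3 + (length holes + r)) (3 + (n + n + n + length holes + r))
gdp-of-system {n} {holes} system r =
  GDPWith-cong refl count pairs-count refl
    (G , present (LAny.here refl) , present (LAny.there (LAny.here refl))
       , present (LAny.there (LAny.there (LAny.here refl))))
  where
  open TripleSystem system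
  m K : ℕ
  m = n + n + n + length holes
  K = 3 + (m + r)

  top P : List ℕ
  top = interval (3 + m) r
  P   = 1 ∷ 2 ∷ K ∷ holes ++ top

  upper-part : (interval 3 m ++ top) ++ [ K ] ≡ interval 3 (suc (m + r))
  upper-part = begin
    (interval 3 m ++ top) ++ [ K ]
      ≡⟨ ++-assoc (interval 3 m) top [ K ] ⟩
    interval 3 m ++ interval (3 + m) r ++ [ K ]
      ≡⟨ cong (interval 3 m ++_) (interval-++ (3 + m) r 1) ⟨
    interval 3 m ++ interval (3 + m) (r + 1)
      ≡⟨ interval-++ 3 m (r + 1) ⟨
    interval 3 (m + (r + 1))
      ≡⟨ cong (interval 3) (trans (cong (m +_) (+-comm r 1)) (+-suc m r)) ⟩
    interval 3 (suc (m + r))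
      ∎
    where open ≡-Reasoning

  completed : halves triples ++ P ↭ interval 1 K
  completed = begin
    halves triples ++ P
      ↭⟨ solve 5 (λ T O U Z S → T ⊕ (O ⊕ U ⊕ Z ⊕ S) ⊜ O ⊕ U ⊕ ((T ⊕ S) ⊕ Z))
               ↭-refl (halves triples) [ 1 ] [ 2 ] [ K ] (holes ++ top) ⟩
    1 ∷ 2 ∷ (halves triples ++ holes ++ top) ++ [ K ]
      ↭⟨ prep 1 (prep 2 (++⁺ʳ [ K ] (↭-trans (↭-reflexive (sym (++-assoc (halves triples) holes top)))
                                              (++⁺ʳ top partition)))) ⟩
    1 ∷ 2 ∷ (interval 3 m ++ top) ++ [ K ]
      ≡⟨ cong (λ rest → 1 ∷ 2 ∷ rest) upper-part ⟩
    interval 1 K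
      ∎
    where open PermutationReasoning

  pairs-count : length P ≡ 3 + (length holes + r)
  pairs-count = cong (3 +_)
    (trans (length-++ holes) (cong (length holes +_) (interval-length (3 + m) r)))

  G : GDP (suc K + suc K) (length triples) (length P)
  G = proj₁ (gdp-of-partition K triples P completed)

  present : ∀ {v} → v ∈ P → Any (_↭ pair v) (GDP.pairs G)
  present = proj₂ (gdp-of-partition K triples P completed)

system₀ : TripleSystem 0 []
system₀ = record { triples = [] ; count = refl ; partition = ↭-refl }

system₁ : TripleSystem 1 (5 ∷ 6 ∷ [])
system₁ = record
  { triples = (3 , 4) ∷ [] ; count = refl ; partition = ↭-by-sorting _ _ refl }

system₂ : TripleSystem 2 (7 ∷ 9 ∷ [])
system₂ = record
  { triples = (3 , 5) ∷ (4 , 6) ∷ [] ; count = refl ; partition = ↭-by-sorting _ _ refl }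

sumOf : ℕ × ℕ → ℕ
sumOf (a , x) = a + x

halves-split : ∀ T → halves T ↭ map proj₁ T ++ (map proj₂ T ++ map sumOf T)
halves-split []            = ↭-refl
halves-split ((a , x) ∷ T) =
  ↭-trans (++⁺ˡ (a ∷ a + x ∷ x ∷ []) (halves-split T))
    (solve 6 (λ A S X As Xs Ss → (A ⊕ S ⊕ X) ⊕ (As ⊕ Xs ⊕ Ss) ⊜ (A ⊕ As) ⊕ ((X ⊕ Xs) ⊕ (S ⊕ Ss)))
       ↭-refl [ a ] [ a + x ] [ x ] (map proj₁ T) (map proj₂ T) (map sumOf T))

stride2 : ℕ → ℕ → List ℕ
stride2 d zero    = []
stride2 d (suc k) = d ∷ stride2 (2 + d) k

stride2-++ : ∀ d k j → stride2 d (k + j) ≡ stride2 d k ++ stride2 (k + k + d) j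
stride2-++ d zero    j = refl
stride2-++ d (suc k) j = cong (d ∷_) (trans (stride2-++ (2 + d) k j)
  (cong (λ d' → stride2 (2 + d) k ++ stride2 d' j) (shift-start k d)))
  where
  shift-start : ∀ k d → k + k + (2 + d) ≡ suc k + suc k + d
  shift-start = solve-∀

interleave-even : ∀ d k → stride2 d k ++ stride2 (suc d) k ↭ interval d (k + k)
interleave-odd  : ∀ d k → stride2 d (suc k) ++ stride2 (suc d) k ↭ interval d (suc (k + k))

interleave-even d zero    = ↭-refl
interleave-even d (suc k) =
  prep d (↭-trans (++-comm (stride2 (2 + d) k) (stride2 (suc d) (suc k)))
         (↭-trans (interleave-odd (suc d) k) (↭-reflexive (cong (interval (suc d)) (sym (+-suc k k))))))
interleave-odd d k =
  prep d (↭-trans (++-comm (stride2 (2 + d) k) (stride2 (suc d) k)) (interleave-even (suc d) k))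

-- nested L d k = (d , L + k - 1), (d + 2 , L + k - 2), …, (d + 2k - 2 , L):
-- the labels rise by 2 while the seconds fall by 1, so the sums rise by 1.
nested : ℕ → ℕ → ℕ → List (ℕ × ℕ)
nested L d zero    = []
nested L d (suc k) = (d , L + k) ∷ nested L (2 + d) k

nested-length : ∀ L d k → length (nested L d k) ≡ k
nested-length L d zero    = refl
nested-length L d (suc k) = cong suc (nested-length L (2 + d) k)

nested-labels : ∀ L d k → map proj₁ (nested L d k) ≡ stride2 d k
nested-labels L d zero    = refl
nested-labels L d (suc k) = cong (d ∷_) (nested-labels L (2 + d) k)

nested-seconds : ∀ L d k → map proj₂ (nested L d k) ↭ interval L k
nested-seconds L d zero    = ↭-refl
nested-seconds L d (suc k) = begin
  L + k ∷ map proj₂ (nested L (2 + d) k)  <⟨ nested-seconds L (2 + d) k ⟩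
  L + k ∷ interval L k                    ↭⟨ ++-comm [ L + k ] (interval L k) ⟩
  interval L k ++ [ L + k ]               ≡⟨ interval-++ L k 1 ⟨
  interval L (k + 1)                      ≡⟨ cong (interval L) (+-comm k 1) ⟩
  interval L (suc k)                      ∎
  where open PermutationReasoning

nested-sums : ∀ L d k → map sumOf (nested L (suc d) k) ≡ interval (L + k + d) k
nested-sums L d zero    = refl
nested-sums L d (suc k) = cong₂ _∷_ (first-sum L k d)
  (trans (nested-sums L (2 + d) k) (cong (λ b → interval b k) (next-start L k d)))
  where
  first-sum : ∀ L k d → suc d + (L + k) ≡ L + suc k + d
  first-sum = solve-∀
  next-start : ∀ L k d → L + k + (2 + d) ≡ suc (L + suc k + d)
  next-start = solve-∀

-- The nested triple system of order n = p + 2 + e: a nested family of p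
-- triples with odd labels 3, 5, …, two middle triples with labels 2p + 3 and
-- 2p + 5, and a nested family of e triples with even labels 4, 6, ….  Its
-- seconds and sums fill the interval c₀ = n + 3, …, c₀ + 2n except for one
-- position among c₄, c₄ + 1, c₄ + 2, which becomes the hole.
module NestedSystem (p e : ℕ) where

  n : ℕ
  n = p + (2 + e)

  -- c₀ < c₁ < … < c₅ cut the interval c₀, …, c₀ + 2n into blocks of the
  -- lengths p, 2, p, e, 3, e.
  c₀ c₁ c₂ c₃ c₄ c₅ : ℕ
  c₀ = 3 + n
  c₁ = c₀ + p
  c₂ = c₁ + 2
  c₃ = c₂ + p
  c₄ = c₃ + e
  c₅ = c₄ + 3

  triples : List (ℕ × ℕ)
  triples = nested c₀ 3 p ++ (p + p + 3 , suc c₁) ∷ (2 + (p + p + 3) , c₁) ∷ nested c₃ 4 e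

  g₁ g₂ : ℕ
  g₁ = p + p + 3 + suc c₁
  g₂ = 2 + (p + p + 3) + c₁

  count : length triples ≡ n
  count = trans (length-++ (nested c₀ 3 p))
    (cong₂ (λ k j → k + (2 + j)) (nested-length c₀ 3 p) (nested-length c₃ 4 e))

  labels : map proj₁ triples ≡ stride2 3 (p + 2) ++ stride2 4 e
  labels = begin
    map proj₁ triples
      ≡⟨ map-++ proj₁ (nested c₀ 3 p) _ ⟩
    map proj₁ (nested c₀ 3 p) ++ p + p + 3 ∷ 2 + (p + p + 3) ∷ map proj₁ (nested c₃ 4 e)
      ≡⟨ cong₂ (λ xs ys → xs ++ p + p + 3 ∷ 2 + (p + p + 3) ∷ ys)
               (nested-labels c₀ 3 p) (nested-labels c₃ 4 e) ⟩
    stride2 3 p ++ stride2 (p + p + 3) 2 ++ stride2 4 e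
      ≡⟨ ++-assoc (stride2 3 p) (stride2 (p + p + 3) 2) (stride2 4 e) ⟨
    (stride2 3 p ++ stride2 (p + p + 3) 2) ++ stride2 4 e
      ≡⟨ cong (_++ stride2 4 e) (stride2-++ 3 p 2) ⟨
    stride2 3 (p + 2) ++ stride2 4 e
      ∎
    where open ≡-Reasoning

  seconds : map proj₂ triples ↭ interval c₀ p ++ suc c₁ ∷ c₁ ∷ interval c₃ e
  seconds = ↭-trans (↭-reflexive (map-++ proj₂ (nested c₀ 3 p) _))
    (++⁺ (nested-seconds c₀ 3 p) (prep (suc c₁) (prep c₁ (nested-seconds c₃ 4 e))))

  sums : map sumOf triples ≡ interval c₂ p ++ g₁ ∷ g₂ ∷ interval c₅ e
  sums = trans (map-++ sumOf (nested c₀ 3 p) _)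
    (cong₂ (λ xs ys → xs ++ g₁ ∷ g₂ ∷ ys) (nested-sums c₀ 2 p) (nested-sums c₃ 3 e))

  blocks : interval c₀ (p + (2 + (p + (e + (3 + e))))) ≡
    interval c₀ p ++ interval c₁ 2 ++ interval c₂ p ++ interval c₃ e ++ interval c₄ 3 ++ interval c₅ e
  blocks =
    trans (interval-++ c₀ p _) (cong (interval c₀ p ++_)
    (trans (interval-++ c₁ 2 _) (cong (interval c₁ 2 ++_)
    (trans (interval-++ c₂ p _) (cong (interval c₂ p ++_)
    (trans (interval-++ c₃ e _) (cong (interval c₃ e ++_)
    (interval-++ c₄ 3 e))))))))

  others : ∀ hole → g₁ ∷ g₂ ∷ hole ∷ [] ↭ interval c₄ 3 →
    (map proj₂ triples ++ map sumOf triples) ++ [ hole ] ↭ interval c₀ (n + n + 1)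
  others hole gaps = begin
    (map proj₂ triples ++ map sumOf triples) ++ [ hole ]
      ↭⟨ ++⁺ʳ [ hole ] (++⁺ seconds (↭-reflexive sums)) ⟩
    ((I₀ ++ suc c₁ ∷ c₁ ∷ I₃) ++ (I₂ ++ g₁ ∷ g₂ ∷ I₅)) ++ [ hole ]
      ↭⟨ solve 9 (λ J₀ Y X J₃ J₂ G₁ G₂ J₅ Z →
                   ((J₀ ⊕ (Y ⊕ X ⊕ J₃)) ⊕ (J₂ ⊕ (G₁ ⊕ G₂ ⊕ J₅))) ⊕ Z
                     ⊜ J₀ ⊕ ((X ⊕ Y) ⊕ (J₂ ⊕ (J₃ ⊕ ((G₁ ⊕ G₂ ⊕ Z) ⊕ J₅)))))
               ↭-refl I₀ [ suc c₁ ] [ c₁ ] I₃ I₂ [ g₁ ] [ g₂ ] I₅ [ hole ] ⟩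
    I₀ ++ interval c₁ 2 ++ I₂ ++ I₃ ++ (g₁ ∷ g₂ ∷ hole ∷ []) ++ I₅
      ↭⟨ ++⁺ˡ I₀ (++⁺ˡ (interval c₁ 2) (++⁺ˡ I₂ (++⁺ˡ I₃ (++⁺ʳ I₅ gaps)))) ⟩
    I₀ ++ interval c₁ 2 ++ I₂ ++ I₃ ++ interval c₄ 3 ++ I₅
      ≡⟨ blocks ⟨
    interval c₀ (p + (2 + (p + (e + (3 + e)))))
      ≡⟨ cong (interval c₀) (length-others p e) ⟨
    interval c₀ (n + n + 1)
      ∎
    where
    open PermutationReasoning
    I₀ I₂ I₃ I₅ : List ℕ
    I₀ = interval c₀ p
    I₂ = interval c₂ p
    I₃ = interval c₃ e
    I₅ = interval c₅ e
    length-others : ∀ p e → p + (2 + e) + (p + (2 + e)) + 1 ≡ p + (2 + (p + (e + (3 + e))))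
    length-others = solve-∀

  system : stride2 3 (p + 2) ++ stride2 4 e ↭ interval 3 n →
           ∀ hole → g₁ ∷ g₂ ∷ hole ∷ [] ↭ interval c₄ 3 → TripleSystem n [ hole ]
  system labels-fill hole gaps = record
    { triples   = triples
    ; count     = count
    ; partition = begin
        halves triples ++ [ hole ]
          ↭⟨ ++⁺ʳ [ hole ] (halves-split triples) ⟩
        (map proj₁ triples ++ (map proj₂ triples ++ map sumOf triples)) ++ [ hole ]
          ≡⟨ ++-assoc (map proj₁ triples) _ [ hole ] ⟩
        map proj₁ triples ++ (map proj₂ triples ++ map sumOf triples) ++ [ hole ]
          ↭⟨ ++⁺ (↭-trans (↭-reflexive labels) labels-fill) (others hole gaps) ⟩
        interval 3 n ++ interval c₀ (n + n + 1)
          ≡⟨ interval-++ 3 n (n + n + 1) ⟨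
        interval 3 (n + (n + n + 1))
          ≡⟨ cong (interval 3) (three-n n) ⟩
        interval 3 (n + n + n + 1)
          ∎
    }
    where
    open PermutationReasoning
    three-n : ∀ n → n + (n + n + 1) ≡ n + n + n + 1
    three-n = solve-∀

odd-system : ∀ p → TripleSystem (3 + (p + p)) [ NestedSystem.c₄ p (suc p) ]
odd-system p = subst (λ n → TripleSystem n [ c₄ ]) (order p) (system labels-fill c₄ gaps)
  where
  open NestedSystem p (suc p)

  order : ∀ p → p + (2 + suc p) ≡ 3 + (p + p)
  order = solve-∀

  labels-fill : stride2 3 (p + 2) ++ stride2 4 (suc p) ↭ interval 3 n
  labels-fill = subst₂ (λ k l → stride2 3 k ++ stride2 4 (suc p) ↭ interval 3 l)
    (+-comm 2 p) (length-labels p) (interleave-odd 3 (suc p))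
    where
    length-labels : ∀ p → suc (suc p + suc p) ≡ p + (2 + suc p)
    length-labels = solve-∀

  -- With c₄ = c₁ + 2 + p + (p + 1), the middle sums are c₄ + 1 and c₄ + 2.
  first-gap : ∀ c₁ p → p + p + 3 + suc c₁ ≡ suc (c₁ + 2 + p + suc p)
  first-gap = solve-∀

  second-gap : ∀ c₁ p → 2 + (p + p + 3) + c₁ ≡ 2 + (c₁ + 2 + p + suc p)
  second-gap = solve-∀

  gaps : g₁ ∷ g₂ ∷ c₄ ∷ [] ↭ interval c₄ 3
  gaps = ↭-trans (shift c₄ (g₁ ∷ g₂ ∷ []) [])
    (↭-reflexive (cong₂ (λ a b → c₄ ∷ a ∷ b ∷ []) (first-gap c₁ p) (second-gap c₁ p)))

even-system : ∀ p → TripleSystem (4 + (p + p)) [ 2 + NestedSystem.c₄ p (2 + p) ]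
even-system p = subst (λ n → TripleSystem n [ 2 + c₄ ]) (order p) (system labels-fill (2 + c₄) gaps)
  where
  open NestedSystem p (2 + p)

  order : ∀ p → p + (2 + (2 + p)) ≡ 4 + (p + p)
  order = solve-∀

  labels-fill : stride2 3 (p + 2) ++ stride2 4 (2 + p) ↭ interval 3 n
  labels-fill = subst₂ (λ k l → stride2 3 k ++ stride2 4 (2 + p) ↭ interval 3 l)
    (+-comm 2 p) (length-labels p) (interleave-even 3 (2 + p))
    where
    length-labels : ∀ p → (2 + p) + (2 + p) ≡ p + (2 + (2 + p))
    length-labels = solve-∀

  -- With c₄ = c₁ + 2 + p + (p + 2), the middle sums are c₄ and c₄ + 1.
  first-gap : ∀ c₁ p → p + p + 3 + suc c₁ ≡ c₁ + 2 + p + (2 + p)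
  first-gap = solve-∀

  second-gap : ∀ c₁ p → 2 + (p + p + 3) + c₁ ≡ suc (c₁ + 2 + p + (2 + p))
  second-gap = solve-∀

  gaps : g₁ ∷ g₂ ∷ 2 + c₄ ∷ [] ↭ interval c₄ 3
  gaps = ↭-reflexive (cong₂ (λ a b → a ∷ b ∷ 2 + c₄ ∷ []) (first-gap c₁ p) (second-gap c₁ p))

parity : ∀ m → Σ ℕ (λ p → m ≡ p + p) ⊎ Σ ℕ (λ p → m ≡ suc (p + p))
parity zero    = inj₁ (0 , refl)
parity (suc m) with parity m
... | inj₁ (p , m≡2p)   = inj₂ (p , cong suc m≡2p)
... | inj₂ (p , m≡2p+1) = inj₁ (suc p , trans (cong suc m≡2p+1) (cong suc (sym (+-suc p p))))

system-for : ∀ n s → 2 ≤ s → ¬ (n ≡ 1 × s ≡ 2) → ¬ (n ≡ 2 × s ≡ 2) →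
  Σ (List ℕ) λ holes → Σ ℕ λ r → TripleSystem n holes × suc (length holes + r) ≡ s
system-for n                   zero                ()
system-for n                   (suc zero)          (s≤s ())
system-for zero                (suc (suc t))       _ _ _ = [] , suc t , system₀ , refl
system-for (suc zero)          (suc (suc zero))    _ not-1-2 _ = ⊥-elim (not-1-2 (refl , refl))
system-for (suc zero)          (suc (suc (suc t))) _ _ _ = _ , t , system₁ , refl
system-for (suc (suc zero))    (suc (suc zero))    _ _ not-2-2 = ⊥-elim (not-2-2 (refl , refl))
system-for (suc (suc zero))    (suc (suc (suc t))) _ _ _ = _ , t , system₂ , refl
system-for (suc (suc (suc m))) (suc (suc t))       _ _ _ with parity m
... | inj₁ (p , refl) = _ , t , odd-system p , refl
... | inj₂ (p , refl) = _ , t , even-system p , refl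

module Parameters (n j r : ℕ) where

  s w₁ K : ℕ
  s  = suc (j + r)
  w₁ = suc (s + n)
  K  = 3 + (n + n + n + j + r)

  modulus : 6 * w₁ ∸ 4 * s ≡ suc K + suc K
  modulus = begin
    6 * w₁ ∸ 4 * s                    ≡⟨ cong (_∸ 4 * s) (expand n j r) ⟩
    4 * s + (suc K + suc K) ∸ 4 * s   ≡⟨ m+n∸m≡n (4 * s) (suc K + suc K) ⟩
    suc K + suc K                     ∎
    where
    open ≡-Reasoning
    expand : ∀ n j r → 6 * suc (suc (j + r) + n) ≡
      4 * suc (j + r) + (4 + (n + n + n + j + r) + (4 + (n + n + n + j + r)))
    expand = solve-∀

  half-modulus : (suc K + suc K) / 2 ∸ 1 ≡ K
  half-modulus = cong (_∸ 1) (trans (cong (_/ 2) (twice (suc K))) (m*n/n≡m (suc K) 2))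
    where
    twice : ∀ k → k + k ≡ k * 2
    twice = solve-∀

  triple-count : w₁ ∸ s ∸ 1 ≡ n
  triple-count = cong (_∸ 1) (trans (cong (_∸ s) (sym (+-suc s n))) (m+n∸m≡n s (suc n)))

  pair-count : 3 + (j + r) ≡ s + 2
  pair-count = cong suc (+-comm 2 (j + r))

proposition20 : (w₁ s : ℕ) → 2 ≤ s → s < w₁
    → ¬ (w₁ ≡ 4 × s ≡ 2) → ¬ (w₁ ≡ 5 × s ≡ 2)
    → Σ (GDP (6 * w₁ ∸ 4 * s) (w₁ ∸ s ∸ 1) (s + 2)) λ G →
    Any (_↭ (0 ∷ 1 ∷ [])) (GDP.pairs G)
    × Any (_↭ (0 ∷ 2 ∷ [])) (GDP.pairs G)
    × Any (_↭ (0 ∷ ((6 * w₁ ∸ 4 * s) / 2 ∸ 1) ∷ [])) (GDP.pairs G)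
proposition20 w₁ s 2≤s s<w₁ not-4-2 not-5-2
  with n , refl ← m≤n⇒∃[o]m+o≡n s<w₁
  with holes , r , system , refl ←
         system-for n s 2≤s (λ { (refl , refl) → not-4-2 (refl , refl) })
                            (λ { (refl , refl) → not-5-2 (refl , refl) })
  = GDPWith-cong (sym modulus) (sym triple-count) pair-count
      (trans (sym half-modulus) (cong (λ μ → μ / 2 ∸ 1) (sym modulus)))
      (gdp-of-system system r)
  where open Parameters n (length holes) r using (modulus; half-modulus; triple-count; pair-count)
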